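{- Let $r\ge 1$ and $k\ge 1$ be integers, and let $T$ satisfy $T(n)=\sum_{p=1}^{k} T(S_p(n))$ for $n>r$ with $r$ given initial values, where each spot function $S_p(n)$ depends only on $n$ and the values $T(j)$, $j<n$, and satisfies $1\le S_p(n)<n$ for $n>r$. Fix $p$ and define $M_p(n)=1$ for $1\le n\le r$, $M_p(n)=M_p(S_p(n))+1$ for $n>r$. For $g\ge1$ let $G_p(g)=M_p^{ -1}(\{g\})$, $\alpha_p(g)=\min G_p(g)$ and $\beta_p(g)=\max G_p(g)$ (when these exist). If $(S_p(n))_{n>r}$ is slow-growing, then the generation structure with respect to $M_p$ is an interval structure: every nonempty generation $G_p(g)$ is a set of consecutive positive integers (equal to $[\alpha_p(g),\beta_p(g)]$ when it is finite, and to $[\alpha_p(g),\infty)$ otherwise). Further, for $g\ge1$, whenever $G_p(g+1)$ is nonempty, $G_p(g)$ is finite and $\beta_p(g)=\alpha_p(g+1)-1$.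
   Context: A sequence is slow-growing if it is nondecreasing with successive differences in $\{0,1\}$. $G_p(g)$ is the $g$-th generation with respect to the $p$-th spot function; $\alpha_p(g)$ and $\beta_p(g)$ are its beginning and end. -}

module Defs where

open import Data.Nat using (ℕ; zero; suc; _≤_; _<_)
open import Data.Integer using (ℤ; _+_) renaming (0ℤ to 0ℤ')
open import Data.Fin using (Fin; zero; suc)
open import Data.Sum using (_⊎_)
open import Data.Product using (_×_; Σ)
open import Relation.Binary.PropositionalEquality using (_≡_)

-- Sum of f p over p ∈ Fin k (i.e. p = 1..k, zero-indexed).
sumFin : (k : ℕ) → (Fin k → ℤ) → ℤ
sumFin zero    f = 0ℤ'
sumFin (suc k) f = f zero + sumFin k (λ p → f (suc p))

SpotFun : Set
SpotFun = (n : ℕ) → ((j : ℕ) → j < n → ℤ) → ℕ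

spot : SpotFun → (ℕ → ℤ) → ℕ → ℕ
spot F T n = F n (λ j _ → T j)

IsSolution : (r k : ℕ) → (Fin k → SpotFun) → (ℕ → ℤ) → Set
IsSolution r k F T =
  ((p : Fin k) (n : ℕ) → r < n → (1 ≤ spot (F p) T n) × (spot (F p) T n < n))
  × ((n : ℕ) → r < n → T n ≡ sumFin k (λ p → T (spot (F p) T n)))

SlowGrowing : (r : ℕ) → (ℕ → ℕ) → Set
SlowGrowing r S = (n : ℕ) → r < n → (S (suc n) ≡ S n) ⊎ (S (suc n) ≡ suc (S n))

IsGenFun : (r : ℕ) → (ℕ → ℕ) → (ℕ → ℕ) → Set
IsGenFun r S M =
  ((n : ℕ) → 1 ≤ n → n ≤ r → M n ≡ 1)
  × ((n : ℕ) → r < n → M n ≡ suc (M (S n)))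

InGen : (ℕ → ℕ) → ℕ → ℕ → Set
InGen M g n = (1 ≤ n) × (M n ≡ g)

IsInterval : (ℕ → Set) → Set
IsInterval G = (a b c : ℕ) → G a → G c → a ≤ b → b ≤ c → G b

IsMax : (ℕ → Set) → ℕ → Set
IsMax G β = G β × ((n : ℕ) → G n → n ≤ β)

IsMin : (ℕ → Set) → ℕ → Set
IsMin G α = G α × ((n : ℕ) → G n → α ≤ n)

module Submission where

-- Idea of the proof.  Call a function f : ℕ → ℕ slow on [1,∞) if every step
-- f n ↦ f (n+1) with n ≥ 1 is +0 or +1.  The argument has two halves.
--
-- (1) Generation functions inherit slowness.  If the spot function S is
--     slow-growing on (r,∞) and 1 ≤ S n < n there, then M, defined by
--     M = 1 on [1,r] and M n = M (S n) + 1 beyond, is slow on [1,∞).  This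
--     is strong induction on n: for n > r, M (n+1) - M n equals
--     M (S (n+1)) - M (S n), and S (n+1) is either S n or its successor
--     S n + 1 with S n < n.
-- (2) Level sets of slow functions.  A slow function is monotone on [1,∞),
--     so each level set {n ≥ 1 | M n = g} is an interval.  If g ≥ M 1 and
--     level g+1 is reached, then M must cross from ≤ g to > g at some step
--     j ↦ j+1; as the step is at most 1, M j = g and M (j+1) = g+1, so j is
--     the maximum of level g and j+1 the minimum of level g+1.
--
-- The corollary applies (2) to the function produced by (1); M 1 = 1 ≤ g.

open import Defs
open import Data.Nat using (ℕ; zero; suc; _≤_; _<_; _≤?_; z≤n; s≤s)
open import Data.Nat.Properties
open import Data.Nat.Induction using (<-rec)
open import Data.Integer using (ℤ)
open import Data.Fin using (Fin)
open import Data.Product using (_×_; Σ; ∃; _,_; proj₁; proj₂)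
open import Data.Sum using (_⊎_; inj₁; inj₂)
open import Data.Empty using (⊥-elim)
open import Relation.Nullary using (yes; no)
open import Relation.Binary using (tri<; tri≈; tri>)
open import Relation.Binary.PropositionalEquality

_↝_ : ℕ → ℕ → Set
a ↝ b = (b ≡ a) ⊎ (b ≡ suc a)

↝-suc : ∀ {a b} → a ↝ b → suc a ↝ suc b
↝-suc (inj₁ b≡a)  = inj₁ (cong suc b≡a)
↝-suc (inj₂ b≡1+a) = inj₂ (cong suc b≡1+a)

↝⇒≤ : ∀ {a b} → a ↝ b → a ≤ b
↝⇒≤ (inj₁ b≡a)  = ≤-reflexive (sym b≡a)
↝⇒≤ (inj₂ b≡1+a) = ≤-trans (n≤1+n _) (≤-reflexive (sym b≡1+a))

↝⇒≤suc : ∀ {a b} → a ↝ b → b ≤ suc a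
↝⇒≤suc (inj₁ b≡a)  = ≤-trans (≤-reflexive b≡a) (n≤1+n _)
↝⇒≤suc (inj₂ b≡1+a) = ≤-reflexive b≡1+a

SlowFrom1 : (ℕ → ℕ) → Set
SlowFrom1 f = (n : ℕ) → 1 ≤ n → f n ↝ f (suc n)

module GenerationFunction
  (r : ℕ) (S M : ℕ → ℕ)
  (spot-bounds : (n : ℕ) → r < n → (1 ≤ S n) × (S n < n))
  (gen-init    : (n : ℕ) → 1 ≤ n → n ≤ r → M n ≡ 1)
  (gen-step    : (n : ℕ) → r < n → M n ≡ suc (M (S n)))
  (S-slow      : SlowGrowing r S)
  where

  -- Beyond r, a step of M is a shifted step of M along the spot function:
  -- S (n+1) is S n (a +0 step) or S n + 1, an earlier step of M.
  M-slow : SlowFrom1 M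
  M-slow = <-rec (λ n → 1 ≤ n → M n ↝ M (suc n)) slowAt
    where
    slowAt : ∀ n → (∀ {m} → m < n → 1 ≤ m → M m ↝ M (suc m))
           → 1 ≤ n → M n ↝ M (suc n)
    slowAt n ih 1≤n with <-cmp n r
    ... | tri< n<r _ _ =
      inj₁ (trans (gen-init (suc n) (s≤s z≤n) n<r) (sym (gen-init n 1≤n (<⇒≤ n<r))))
    ... | tri≈ _ refl _ =
      inj₂ (trans (gen-step (suc n) ≤-refl) (cong suc (trans M-S-is-1 (sym (gen-init n 1≤n ≤-refl)))))
      where
      M-S-is-1 : M (S (suc n)) ≡ 1
      M-S-is-1 with spot-bounds (suc n) ≤-refl
      ... | 1≤S , S<1+n = gen-init (S (suc n)) 1≤S (≤-pred S<1+n)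
    ... | tri> _ _ r<n =
      subst₂ _↝_ (sym (gen-step n r<n)) (sym (gen-step (suc n) (m≤n⇒m≤1+n r<n)))
             (↝-suc spot-step)
      where
      spot-step : M (S n) ↝ M (S (suc n))
      spot-step with S-slow n r<n
      ... | inj₁ same = inj₁ (cong M same)
      ... | inj₂ next rewrite next =
        ih (proj₂ (spot-bounds n r<n)) (proj₁ (spot-bounds n r<n))

module LevelSets (M : ℕ → ℕ) (M-slow : SlowFrom1 M) where

  monotone : ∀ {a b} → 1 ≤ a → a ≤ b → M a ≤ M b
  monotone {a} {zero}  1≤a a≤0 = ⊥-elim (<⇒≱ 1≤a a≤0)
  monotone {a} {suc b} 1≤a a≤1+b with m≤n⇒m<n∨m≡n a≤1+b
  ... | inj₂ refl      = ≤-refl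
  ... | inj₁ (s≤s a≤b) = ≤-trans (monotone 1≤a a≤b) (↝⇒≤ (M-slow b (≤-trans 1≤a a≤b)))

  level-interval : (g : ℕ) → IsInterval (InGen M g)
  level-interval g a b c (1≤a , Ma≡g) (_ , Mc≡g) a≤b b≤c =
    1≤b , ≤-antisym (subst (M b ≤_) Mc≡g (monotone 1≤b b≤c))
                    (subst (_≤ M b) Ma≡g (monotone 1≤a a≤b))
    where
    1≤b : 1 ≤ b
    1≤b = ≤-trans 1≤a a≤b

  crossing-step : ∀ {g} j → 1 ≤ j → M j ≤ g → g < M (suc j)
                → (M j ≡ g) × (M (suc j) ≡ suc g)
  crossing-step {g} j 1≤j Mj≤g g<M1+j = Mj≡g , M1+j≡1+g
    where
    M1+j≡1+g : M (suc j) ≡ suc g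
    M1+j≡1+g = ≤-antisym (≤-trans (↝⇒≤suc (M-slow j 1≤j)) (s≤s Mj≤g)) g<M1+j
    Mj≡g : M j ≡ g
    Mj≡g = ≤-antisym Mj≤g (≤-pred (subst (_≤ suc (M j)) M1+j≡1+g (↝⇒≤suc (M-slow j 1≤j))))

  crossing : ∀ g m → M 1 ≤ g → g < M (suc m)
           → Σ ℕ (λ j → (1 ≤ j) × (M j ≡ g) × (M (suc j) ≡ suc g))
  crossing g zero    M1≤g g<M1 = ⊥-elim (<⇒≱ g<M1 M1≤g)
  crossing g (suc m) M1≤g g<M2+m with M (suc m) ≤? g
  ... | yes M1+m≤g = suc m , s≤s z≤n , crossing-step (suc m) (s≤s z≤n) M1+m≤g g<M2+m
  ... | no  M1+m≰g = crossing g m M1≤g (≰⇒> M1+m≰g)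

  -- If level g+1 is nonempty and g ≥ M 1, level g ends exactly where level
  -- g+1 begins: the crossing step j ↦ j+1 marks both ends, by monotonicity.
  next-level : (g : ℕ) → M 1 ≤ g → ∃ (InGen M (suc g))
             → Σ ℕ (λ β → IsMax (InGen M g) β × IsMin (InGen M (suc g)) (suc β))
  next-level g M1≤g (suc n , _ , M1+n≡1+g)
    with crossing g n M1≤g (≤-reflexive (sym M1+n≡1+g))
  ... | j , 1≤j , Mj≡g , M1+j≡1+g =
    j , ((1≤j , Mj≡g) , below-j) , ((s≤s z≤n , M1+j≡1+g) , above-j)
    where
    below-j : (m : ℕ) → InGen M g m → m ≤ j
    below-j m (_ , Mm≡g) = ≮⇒≥ λ j<m →
      <⇒≱ (≤-reflexive (sym M1+j≡1+g)) (subst (M (suc j) ≤_) Mm≡g (monotone (s≤s z≤n) j<m))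
    above-j : (m : ℕ) → InGen M (suc g) m → suc j ≤ m
    above-j m (1≤m , Mm≡1+g) = ≮⇒≥ λ m<1+j →
      <⇒≱ (≤-reflexive (sym Mm≡1+g)) (subst (M m ≤_) Mj≡g (monotone 1≤m (≤-pred m<1+j)))

corollary1 : (r k : ℕ) → 1 ≤ r → 1 ≤ k
    → (F : Fin k → SpotFun) (T : ℕ → ℤ) → IsSolution r k F T
    → (p : Fin k) (M : ℕ → ℕ) → IsGenFun r (spot (F p) T) M
    → SlowGrowing r (spot (F p) T)
    → ((g : ℕ) → 1 ≤ g → IsInterval (InGen M g))
      × ((g : ℕ) → 1 ≤ g → ∃ (InGen M (suc g))
          → Σ ℕ (λ β → IsMax (InGen M g) β × IsMin (InGen M (suc g)) (suc β)))
corollary1 r k 1≤r _ F T (spot-bounds , _) p M (gen-init , gen-step) S-slow =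
  (λ g _ → level-interval g) ,
  (λ g 1≤g → next-level g (subst (_≤ g) (sym M1≡1) 1≤g))
  where
  open GenerationFunction r (spot (F p) T) M (spot-bounds p) gen-init gen-step S-slow
  open LevelSets M M-slow

  M1≡1 : M 1 ≡ 1
  M1≡1 = gen-init 1 ≤-refl 1≤r
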